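{- Let $(a_n)_{n\ge 0}$ be the Narayana sequence, defined by $a_0=0$, $a_1=a_2=1$ and $a_n=a_{n-1}+a_{n-3}$ for all $n\ge 3$. For every integer $i\ge 1$, $$v_3(a_i-1)=\begin{cases} 0, & i\equiv 0,4,5,7 \pmod 8;\\ v_3(i-1)+1, & i\equiv 1 \pmod 8;\\ v_3(i+2)+1, & i\equiv 6 \pmod 8;\\ v_3(i-2)+2, & i\equiv 2 \pmod{24};\\ 2, & i\equiv 10 \pmod{24};\\ v_3\big((i+6)(i+30)\big)+2, & i\equiv 18 \pmod{24};\\ v_3(i-3)+2, & i\equiv 3 \pmod{24};\\ v_3(i+13)+2, & i\equiv 11 \pmod{24};\\ v_3(i+5)+2, & i\equiv 19 \pmod{24}. \end{cases}$$
   Context: For a prime $p$ and a nonzero integer $x$, $v_p(x)$ denotes the exponent of $p$ in the prime factorization of $x$ (the $p$-adic valuation); by convention $v_p(0)=\infty$. -}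

module Defs where

open import Data.Nat using (ℕ; zero; suc; _+_; _*_; _^_)
open import Data.Nat.Divisibility using (_∣_)
open import Data.Maybe using (Maybe; just; nothing)
open import Data.Product using (_×_)
open import Relation.Nullary using (¬_)
open import Relation.Binary.PropositionalEquality using (_≡_)

narayana : ℕ → ℕ
narayana 0 = 0
narayana 1 = 1
narayana 2 = 1
narayana (suc (suc (suc n))) = narayana (suc (suc n)) + narayana n

-- Extended naturals ℕ ∪ {∞}: just k = k, nothing = ∞.
ℕ∞ : Set
ℕ∞ = Maybe ℕ

_+∞_ : ℕ∞ → ℕ → ℕ∞
just k +∞ m = just (k + m)
nothing +∞ m = nothing

HasVal : ℕ → ℕ → ℕ∞ → Set
HasVal p x nothing  = x ≡ 0
HasVal p x (just k) = (p ^ k ∣ x) × ¬ (p ^ suc k ∣ x)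

{-# OPTIONS --safe #-}
module Submission where

-- Let f : ℕ → ℤ satisfy the Narayana recurrence and write Δ_P f n = f (n + P) - f n.
-- Since f (n + 8) = 6 f (n + 2) + 3 f (n + 1) + 4 f n, Δ_8 multiplies the 3-adic content of f
-- by 3, and the binomial identity Δ_{3P} = 3 Δ_P + 3 Δ_P² + Δ_P³ lifts this to period 3^k · 8
-- with gain k + 1.  A first-order expansion then gives, for P = 3^k · 8,
--   f (u · 3^j · P) ≡ f 0 + u · 3^j · Δ_P f 0   (mod 3^(j + 2(k + 1))).
-- Each residue class of i is handled by a shift f of the Narayana sequence (run backwards for
-- negative shifts) with f (M · P) = a_i.  When v₃(Δ_P f 0) < 2(k + 1), the expansion yields
-- v₃(a_i - 1) = v₃(M) + v₃(Δ_P f 0) if f 0 = 1, and v₃(a_i - 1) = v₃(f 0 - 1) if f 0 - 1 is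
-- less divisible than Δ_P f 0.

open import Data.Nat.Primality using (Prime)

module NarayanaSequences where

  open import Data.Nat as ℕ using (ℕ; zero; suc)
  open import Data.Integer using (ℤ; +_; _+_; _-_)
  open import Data.Integer.Properties using (pos-+)
  open import Data.Integer.Tactic.RingSolver using (solve-∀)
  open import Relation.Binary.PropositionalEquality
  open import Defs using (narayana)

  record IsNarayana (f : ℕ → ℤ) : Set where
    field recurrence : ∀ n → f (3 ℕ.+ n) ≡ f (2 ℕ.+ n) + f n
  open IsNarayana

  narayanaℤ : ℕ → ℤ
  narayanaℤ n = + narayana n

  narayanaℤ-isNarayana : IsNarayana narayanaℤ
  narayanaℤ-isNarayana .recurrence n = pos-+ (narayana (2 ℕ.+ n)) (narayana n)

  shift-isNarayana : ∀ {f} c → IsNarayana f → IsNarayana (λ n → f (n ℕ.+ c))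
  shift-isNarayana c nar .recurrence n = nar .recurrence (n ℕ.+ c)

  -- back b f n is "f (n - b)", the recurrence being run backwards below index b;
  -- back b narayanaℤ thus lists the Narayana numbers from index -b on.
  back : ℕ → (ℕ → ℤ) → ℕ → ℤ
  back zero    f n       = f n
  back (suc b) f zero    = back b f 2 - back b f 1
  back (suc b) f (suc n) = back b f n

  back-isNarayana : ∀ {f} b → IsNarayana f → IsNarayana (back b f)
  back-isNarayana zero    nar = nar
  back-isNarayana {f} (suc b) nar .recurrence zero = lemma (back b f 2) (back b f 1)
    where lemma : ∀ x y → x ≡ y + (x - y)
          lemma = solve-∀
  back-isNarayana (suc b) nar .recurrence (suc n) = back-isNarayana b nar .recurrence n

  back-shift : ∀ {f} b n → back b f (b ℕ.+ n) ≡ f n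
  back-shift zero    n = refl
  back-shift (suc b) n = back-shift b n

  Δ : ℕ → (ℕ → ℤ) → ℕ → ℤ
  Δ P f n = f (n ℕ.+ P) - f n

  Δ-isNarayana : ∀ {f} P → IsNarayana f → IsNarayana (Δ P f)
  Δ-isNarayana {f} P nar .recurrence n = begin
    f (3 ℕ.+ n ℕ.+ P) - f (3 ℕ.+ n)
      ≡⟨ cong₂ _-_ (nar .recurrence (n ℕ.+ P)) (nar .recurrence n) ⟩
    (f (2 ℕ.+ n ℕ.+ P) + f (n ℕ.+ P)) - (f (2 ℕ.+ n) + f n)
      ≡⟨ lemma (f (2 ℕ.+ n ℕ.+ P)) (f (n ℕ.+ P)) (f (2 ℕ.+ n)) (f n) ⟩
    Δ P f (2 ℕ.+ n) + Δ P f n ∎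
    where
    open ≡-Reasoning
    lemma : ∀ a b c d → (a + b) - (c + d) ≡ (a - c) + (b - d)
    lemma = solve-∀

module ThreeAdicContent where

  open import Data.Nat as ℕ using (ℕ; zero; suc; _≤_)
  import Data.Nat.Properties as ℕ
  open import Data.Integer using (ℤ; +_; 0ℤ; 1ℤ; _+_; _-_; _*_; _^_)
  open import Data.Integer.Properties using (pos-+; *-zeroˡ; *-identityʳ; +-inverseʳ)
  open import Data.Integer.Divisibility.Signed
  open import Data.Integer.Tactic.RingSolver using (solve-∀)
  import Data.Nat.Tactic.RingSolver as ℕ-Solver
  open import Data.List using (_∷_; [])
  open import Function using (_$_)
  open import Relation.Binary.PropositionalEquality
  open NarayanaSequences
  open IsNarayana

  infix 9 3^_
  3^_ : ℕ → ℤ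
  3^ n = (+ 3) ^ n

  infix 4 _∣ₛ_
  _∣ₛ_ : ℤ → (ℕ → ℤ) → Set
  d ∣ₛ f = ∀ n → d ∣ f n

  record RaisesContent (P g : ℕ) : Set where
    field raise : ∀ a {f} → IsNarayana f → 3^ a ∣ₛ f → 3^ (g ℕ.+ a) ∣ₛ Δ P f
  open RaisesContent

  ∣-≡0 : ∀ {d x} → x ≡ 0ℤ → d ∣ x
  ∣-≡0 {d} x≡0 = divides 0ℤ (trans x≡0 (sym (*-zeroˡ d)))

  3^-∣ : ∀ k {m n} → k ℕ.+ m ≡ n → 3^ m ∣ 3^ n
  3^-∣ zero    refl = ∣-refl
  3^-∣ (suc k) refl = ∣n⇒∣m*n (+ 3) (3^-∣ k refl)

  3^-mono-∣ : ∀ {m n} → m ≤ n → 3^ m ∣ 3^ n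
  3^-mono-∣ {m} {n} m≤n = 3^-∣ (n ℕ.∸ m) {m} (ℕ.m∸n+n≡m m≤n)

  3^0-∣ₛ : ∀ {f} → 3^ 0 ∣ₛ f
  3^0-∣ₛ {f} n = divides (f n) (sym (*-identityʳ (f n)))

  Δ8-factor : ∀ {f} → IsNarayana f → ∀ n →
              Δ 8 f n ≡ + 3 * (+ 2 * f (2 ℕ.+ n) + f (1 ℕ.+ n) + f n)
  Δ8-factor {f} nar n
    rewrite ℕ.+-comm n 8 | recurrence nar (5 ℕ.+ n) | recurrence nar (4 ℕ.+ n)
          | recurrence nar (3 ℕ.+ n) | recurrence nar (2 ℕ.+ n) | recurrence nar (1 ℕ.+ n)
          | recurrence nar n
    = lemma (f (2 ℕ.+ n)) (f (1 ℕ.+ n)) (f n)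
    where
    lemma : ∀ x y z → x + z + y + x + (x + z) + (x + z + y) + (x + z + y + x) - z
                      ≡ + 3 * (+ 2 * x + y + z)
    lemma = solve-∀

  raises-8 : RaisesContent 8 1
  raises-8 .raise a {f} nar div n =
    subst (3^ (1 ℕ.+ a) ∣_) (sym (Δ8-factor nar n)) $
      *-monoʳ-∣ (+ 3) (∣m∣n⇒∣m+n (∣m∣n⇒∣m+n (∣n⇒∣m*n (+ 2) (div (2 ℕ.+ n))) (div (1 ℕ.+ n)))
                                 (div n))

  raises-weaken : ∀ {P g} → RaisesContent P (suc g) → RaisesContent P 1
  raises-weaken {g = g} raises .raise a nar div n =
    ∣-trans (*-monoʳ-∣ (+ 3) (3^-∣ g refl)) (raises .raise a nar div n)

  Δ-triple : ∀ P f n → Δ (3 ℕ.* P) f n - + 3 * Δ P f n ≡ + 3 * Δ P (Δ P f) n + Δ P (Δ P (Δ P f)) n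
  Δ-triple P f n =
    trans (cong (λ m → f m - f n - + 3 * Δ P f n) (index n P))
          (lemma (f n) (f (n ℕ.+ P)) (f (n ℕ.+ P ℕ.+ P)) (f (n ℕ.+ P ℕ.+ P ℕ.+ P)))
    where
    index : ∀ n P → n ℕ.+ 3 ℕ.* P ≡ n ℕ.+ P ℕ.+ P ℕ.+ P
    index = ℕ-Solver.solve-∀
    lemma : ∀ a₀ a₁ a₂ a₃ → a₃ - a₀ - + 3 * (a₁ - a₀)
                            ≡ + 3 * ((a₂ - a₁) - (a₁ - a₀))
                              + (((a₃ - a₂) - (a₂ - a₁)) - ((a₂ - a₁) - (a₁ - a₀)))
    lemma = solve-∀

  Δ-triple-error : ∀ {P g} → RaisesContent P (suc g) → ∀ a {f} → IsNarayana f → 3^ a ∣ₛ f →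
                   ∀ n → 3^ (suc (suc g ℕ.+ (suc g ℕ.+ a))) ∣ Δ (3 ℕ.* P) f n - + 3 * Δ P f n
  Δ-triple-error {P} {g} raises a {f} nar div n =
    subst (_ ∣_) (sym (Δ-triple P f n)) $
      ∣m∣n⇒∣m+n (*-monoʳ-∣ (+ 3) (Δ² n))
                (raises-weaken raises .raise (suc g ℕ.+ (suc g ℕ.+ a)) (Δ-isNarayana P nar-Δ) Δ² n)
    where
    nar-Δ : IsNarayana (Δ P f)
    nar-Δ = Δ-isNarayana P nar
    Δ² : 3^ (suc g ℕ.+ (suc g ℕ.+ a)) ∣ₛ Δ P (Δ P f)
    Δ² = raises .raise (suc g ℕ.+ a) nar-Δ (raises .raise a nar div)

  raises-triple : ∀ {P g} → RaisesContent P (suc g) → RaisesContent (3 ℕ.* P) (2 ℕ.+ g)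
  raises-triple {P} {g} raises .raise a {f} nar div n =
    subst (_ ∣_) (lemma (Δ (3 ℕ.* P) f n) (Δ P f n)) $
      ∣m∣n⇒∣m+n (*-monoʳ-∣ (+ 3) (raises .raise a nar div n))
                (∣-trans (3^-∣ (suc g) exponent) (Δ-triple-error raises a nar div n))
    where
    exponent : suc g ℕ.+ (2 ℕ.+ g ℕ.+ a) ≡ suc (suc g ℕ.+ (suc g ℕ.+ a))
    exponent = ℕ-Solver.solve (g ∷ a ∷ [])
    lemma : ∀ x y → + 3 * y + (x - + 3 * y) ≡ x
    lemma = solve-∀

  raises-pow3 : ∀ {P g} → RaisesContent P (suc g) → ∀ j → RaisesContent (3 ℕ.^ j ℕ.* P) (suc (j ℕ.+ g))
  raises-pow3 {P} {g} raises zero =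
    subst (λ Q → RaisesContent Q (suc g)) (sym (ℕ.*-identityˡ P)) raises
  raises-pow3 {P} {g} raises (suc j) =
    subst (λ Q → RaisesContent Q (2 ℕ.+ j ℕ.+ g)) (sym (ℕ.*-assoc 3 (3 ℕ.^ j) P))
          (raises-triple (raises-pow3 raises j))

  raises-24 : RaisesContent 24 2
  raises-24 = raises-pow3 raises-8 1

  raises-72 : RaisesContent 72 3
  raises-72 = raises-pow3 raises-8 2

  private
    next-index : ∀ n u P → n ℕ.+ u ℕ.* P ℕ.+ P ≡ n ℕ.+ suc u ℕ.* P
    next-index = ℕ-Solver.solve-∀

  Δ-multiple : ∀ {P G} → RaisesContent P G → ∀ a {f} → IsNarayana f → 3^ a ∣ₛ f →
               ∀ u n → 3^ (G ℕ.+ a) ∣ f (n ℕ.+ u ℕ.* P) - f n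
  Δ-multiple raises a {f} nar div zero n =
    ∣-≡0 (trans (cong (λ m → f m - f n) (ℕ.+-identityʳ n)) (+-inverseʳ (f n)))
  Δ-multiple {P} raises a {f} nar div (suc u) n =
    subst (_ ∣_) (telescope (next-index n u P))
      (∣m∣n⇒∣m+n (raises .raise a nar div (n ℕ.+ u ℕ.* P)) (Δ-multiple raises a nar div u n))
    where
    telescope : ∀ {m} → n ℕ.+ u ℕ.* P ℕ.+ P ≡ m →
                Δ P f (n ℕ.+ u ℕ.* P) + (f (n ℕ.+ u ℕ.* P) - f n) ≡ f m - f n
    telescope refl = lemma (f (n ℕ.+ u ℕ.* P ℕ.+ P)) (f (n ℕ.+ u ℕ.* P)) (f n)
      where lemma : ∀ x y z → (x - y) + (y - z) ≡ x - z
            lemma = solve-∀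

  Δ-linear : ∀ {P G} → RaisesContent P G → ∀ a {f} → IsNarayana f → 3^ a ∣ₛ f →
             ∀ u n → 3^ (G ℕ.+ (G ℕ.+ a)) ∣ f (n ℕ.+ u ℕ.* P) - f n - + u * Δ P f n
  Δ-linear {P} raises a {f} nar div zero n =
    ∣-≡0 (trans (cong (λ m → f m - f n - 0ℤ * Δ P f n) (ℕ.+-identityʳ n)) (lemma (f n) (Δ P f n)))
    where lemma : ∀ x y → x - x - 0ℤ * y ≡ 0ℤ
          lemma = solve-∀
  Δ-linear {P} {G} raises a {f} nar div (suc u) n =
    subst (_ ∣_) (split (next-index n u P))
      (∣m∣n⇒∣m+n (Δ-multiple raises (G ℕ.+ a) (Δ-isNarayana P nar) (raises .raise a nar div) u n)
                 (Δ-linear raises a nar div u n))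
    where
    split : ∀ {m} → n ℕ.+ u ℕ.* P ℕ.+ P ≡ m →
            (Δ P f (n ℕ.+ u ℕ.* P) - Δ P f n) + (f (n ℕ.+ u ℕ.* P) - f n - + u * Δ P f n)
              ≡ f m - f n - + suc u * Δ P f n
    split refl =
      trans (lemma (f (n ℕ.+ u ℕ.* P ℕ.+ P)) (f (n ℕ.+ u ℕ.* P)) (f n) (Δ P f n) (+ u))
            (cong (λ k → f (n ℕ.+ u ℕ.* P ℕ.+ P) - f n - k * Δ P f n) (sym (pos-+ 1 u)))
      where lemma : ∀ x y z d v → ((x - y) - d) + (y - z - v * d) ≡ x - z - (1ℤ + v) * d
            lemma = solve-∀

  Δ-pow3 : ∀ {P g} → RaisesContent P (suc g) → ∀ {f} → IsNarayana f → ∀ j n →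
           3^ (j ℕ.+ (suc g ℕ.+ suc g)) ∣ Δ (3 ℕ.^ j ℕ.* P) f n - 3^ j * Δ P f n
  Δ-pow3 {P} raises {f} nar zero n =
    ∣-≡0 (trans (cong (λ Q → Δ Q f n - 1ℤ * Δ P f n) (ℕ.*-identityˡ P)) (lemma (Δ P f n)))
    where lemma : ∀ x → x - 1ℤ * x ≡ 0ℤ
          lemma = solve-∀
  Δ-pow3 {P} {g} raises {f} nar (suc j) n =
    subst (_ ∣_) split $
      ∣m∣n⇒∣m+n (∣-trans (3^-∣ j exponent) (Δ-triple-error (raises-pow3 raises j) 0 nar 3^0-∣ₛ n))
                (*-monoʳ-∣ (+ 3) (Δ-pow3 raises nar j n))
    where
    Q : ℕ
    Q = 3 ℕ.^ j ℕ.* P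
    exponent : j ℕ.+ suc (j ℕ.+ (suc g ℕ.+ suc g)) ≡ suc (suc (j ℕ.+ g) ℕ.+ (suc (j ℕ.+ g) ℕ.+ 0))
    exponent = ℕ-Solver.solve (j ∷ g ∷ [])
    split : (Δ (3 ℕ.* Q) f n - + 3 * Δ Q f n) + + 3 * (Δ Q f n - 3^ j * Δ P f n)
            ≡ Δ (3 ℕ.^ suc j ℕ.* P) f n - 3^ suc j * Δ P f n
    split = trans (lemma (Δ (3 ℕ.* Q) f n) (Δ Q f n) (3^ j) (Δ P f n))
                  (cong (λ R → Δ R f n - 3^ suc j * Δ P f n) (sym (ℕ.*-assoc 3 (3 ℕ.^ j) P)))
      where lemma : ∀ x y t d → (x - + 3 * y) + + 3 * (y - t * d) ≡ x - + 3 * t * d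
            lemma = solve-∀

  expansion : ∀ {P g} → RaisesContent P (suc g) → ∀ {f} → IsNarayana f → ∀ j u n →
              3^ (j ℕ.+ (suc g ℕ.+ suc g))
                ∣ f (n ℕ.+ u ℕ.* (3 ℕ.^ j ℕ.* P)) - f n - + u * 3^ j * Δ P f n
  expansion {P} {g} raises {f} nar j u n =
    subst (_ ∣_) (lemma (f (n ℕ.+ u ℕ.* Q)) (f n) (Δ Q f n) (Δ P f n) (+ u) (3^ j)) $
      ∣m∣n⇒∣m+n (∣-trans (3^-∣ j exponent) (Δ-linear (raises-pow3 raises j) 0 nar 3^0-∣ₛ u n))
                (∣n⇒∣m*n (+ u) (Δ-pow3 raises nar j n))
    where
    Q : ℕ
    Q = 3 ℕ.^ j ℕ.* P
    exponent : j ℕ.+ (j ℕ.+ (suc g ℕ.+ suc g)) ≡ suc (j ℕ.+ g) ℕ.+ (suc (j ℕ.+ g) ℕ.+ 0)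
    exponent = ℕ-Solver.solve (j ∷ g ∷ [])
    lemma : ∀ x y z d u t → (x - y - u * z) + u * (z - t * d) ≡ x - y - u * t * d
    lemma = solve-∀

module Valuation {p} (p-prime : Prime p) where

  open import Data.Nat.Base
  open import Data.Nat.Properties
  open import Data.Nat.Divisibility
  open import Data.Nat.Induction using (<-rec)
  open import Data.Nat.Tactic.RingSolver using (solve-∀)
  open import Data.Nat.Primality using (euclidsLemma; prime⇒nonZero; prime⇒nonTrivial)
  open import Data.Maybe using (just; nothing)
  open import Data.Product using (∃-syntax; _×_; _,_)
  open import Data.Sum using (inj₁; inj₂)
  open import Data.Empty using (⊥-elim)
  open import Relation.Nullary using (¬_; yes; no)
  open import Relation.Binary.Definitions using (tri<; tri≈; tri>)
  open import Relation.Binary.PropositionalEquality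
  open import Defs using (HasVal)

  private instance
    p-nonZero    = prime⇒nonZero p-prime
    p-nonTrivial = prime⇒nonTrivial p-prime

  ^-monoʳ-∣ : ∀ {m n} → m ≤ n → p ^ m ∣ p ^ n
  ^-monoʳ-∣ {m} {n} m≤n = divides (p ^ (n ∸ m)) (begin
    p ^ n               ≡⟨ cong (p ^_) (m+[n∸m]≡n m≤n) ⟨
    p ^ (m + (n ∸ m))   ≡⟨ ^-distribˡ-+-* p m (n ∸ m) ⟩
    p ^ m * p ^ (n ∸ m) ≡⟨ *-comm (p ^ m) (p ^ (n ∸ m)) ⟩
    p ^ (n ∸ m) * p ^ m ∎)
    where open ≡-Reasoning

  ∤-* : ∀ {a b} → ¬ p ∣ a → ¬ p ∣ b → ¬ p ∣ a * b
  ∤-* {a} {b} p∤a p∤b p∣ab with euclidsLemma a b p-prime p∣ab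
  ... | inj₁ p∣a = p∤a p∣a
  ... | inj₂ p∣b = p∤b p∣b

  ∤-+-multiple : ∀ {a} n → ¬ p ∣ a → ¬ p ∣ p * n + a
  ∤-+-multiple n p∤a p∣pn+a = p∤a (∣m+n∣m⇒∣n p∣pn+a (m∣m*n n))

  hasVal-zero : ∀ {r} → HasVal p 0 r → r ≡ nothing
  hasVal-zero {nothing} _        = refl
  hasVal-zero {just k}  (_ , ∤0) = ⊥-elim (∤0 (_ ∣0))

  hasVal-unique : ∀ {x} k {r} → HasVal p x (just k) → HasVal p x r → r ≡ just k
  hasVal-unique k {nothing} (_ , pᵏ⁺¹∤x) refl = ⊥-elim (pᵏ⁺¹∤x (_ ∣0))
  hasVal-unique k {just l} (pᵏ∣x , pᵏ⁺¹∤x) (pˡ∣x , pˡ⁺¹∤x) with <-cmp k l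
  ... | tri< k<l _ _ = ⊥-elim (pᵏ⁺¹∤x (∣-trans (^-monoʳ-∣ k<l) pˡ∣x))
  ... | tri≈ _ refl _ = refl
  ... | tri> _ _ l<k = ⊥-elim (pˡ⁺¹∤x (∣-trans (^-monoʳ-∣ l<k) pᵏ∣x))

  hasVal⇒factor : ∀ {x} k → HasVal p x (just k) → ∃[ q ] x ≡ q * p ^ k × ¬ p ∣ q
  hasVal⇒factor k (divides q x≡q*pᵏ , pᵏ⁺¹∤x) = q , x≡q*pᵏ , p∤q
    where
    p∤q : ¬ p ∣ q
    p∤q (divides q′ refl) = pᵏ⁺¹∤x (divides q′ (trans x≡q*pᵏ (*-assoc q′ p (p ^ k))))

  factor⇒hasVal : ∀ {q} k → ¬ p ∣ q → HasVal p (q * p ^ k) (just k)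
  factor⇒hasVal {q} k p∤q = n∣m*n q , λ pᵏ⁺¹∣ → p∤q (*-cancelʳ-∣ (p ^ k) {{m^n≢0 p k}} pᵏ⁺¹∣)

  hasVal-exists : ∀ x .{{_ : NonZero x}} → ∃[ k ] HasVal p x (just k)
  hasVal-exists = <-rec _ step
    where
    step : ∀ x → (∀ {y} → y < x → .{{_ : NonZero y}} → ∃[ k ] HasVal p y (just k)) →
           .{{_ : NonZero x}} → ∃[ k ] HasVal p x (just k)
    step x rec with p ∣? x
    ... | no p∤x = 0 , 1∣ x , λ p∣x → p∤x (subst (_∣ x) (*-identityʳ p) p∣x)
    ... | yes p∣x@(divides q refl) with rec (quotient-< p∣x) {{m*n≢0⇒m≢0 q}}
    ...   | k , valᑫ with hasVal⇒factor k valᑫ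
    ...     | r , refl , p∤r =
      suc k , subst (λ y → HasVal p y (just (suc k))) (lemma r (p ^ k)) (factor⇒hasVal (suc k) p∤r)
      where lemma : ∀ r t → r * (p * t) ≡ r * t * p
            lemma r t = trans (cong (r *_) (*-comm p t)) (sym (*-assoc r t p))

  hasVal-* : ∀ {a b} j k → HasVal p a (just j) → HasVal p b (just k) → HasVal p (a * b) (just (j + k))
  hasVal-* j k valᵃ valᵇ with hasVal⇒factor j valᵃ | hasVal⇒factor k valᵇ
  ... | q , refl , p∤q | r , refl , p∤r =
    subst (λ y → HasVal p y (just (j + k))) product (factor⇒hasVal (j + k) (∤-* p∤q p∤r))
    where
    product : q * r * p ^ (j + k) ≡ q * p ^ j * (r * p ^ k)
    product = trans (cong (q * r *_) (^-distribˡ-+-* p j k)) (lemma q r (p ^ j) (p ^ k))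
      where lemma : ∀ q r s t → q * r * (s * t) ≡ q * s * (r * t)
            lemma = solve-∀

module NarayanaValuation where

  open import Data.Nat as ℕ using (ℕ; zero; suc; _≤_; _<_)
  import Data.Nat.Properties as ℕ
  import Data.Nat.Divisibility as ℕ
  open import Data.Nat.Primality using (Prime; prime?; euclidsLemma)
  open import Data.Integer using (ℤ; +_; 1ℤ; _+_; _-_; _*_; ∣_∣; NonZero)
  open import Data.Integer.Properties using (abs-*; ^-distribˡ-+-*; *-comm)
  open import Data.Integer.Divisibility.Signed
  open import Data.Integer.Tactic.RingSolver using (solve-∀)
  open import Data.Maybe using (just)
  open import Data.Product using (_,_)
  open import Data.Sum using (_⊎_; inj₁; inj₂)
  open import Function using (_∘_; _$_)
  open import Relation.Nullary using (¬_)
  open import Relation.Nullary.Decidable using (from-yes)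
  open import Relation.Binary.PropositionalEquality
  open import Defs using (HasVal)
  open NarayanaSequences
  open ThreeAdicContent

  prime-3 : Prime 3
  prime-3 = from-yes (prime? 3)

  open Valuation prime-3

  ∣3^n∣ : ∀ n → ∣ 3^ n ∣ ≡ 3 ℕ.^ n
  ∣3^n∣ zero    = refl
  ∣3^n∣ (suc n) = trans (abs-* (+ 3) (3^ n)) (cong (3 ℕ.*_) (∣3^n∣ n))

  3^-nonZero : ∀ n → NonZero (3^ n)
  3^-nonZero n = subst ℕ.NonZero (sym (∣3^n∣ n)) (ℕ.m^n≢0 3 n)

  3^∣⇒∣ : ∀ n {x} → 3^ n ∣ + x → 3 ℕ.^ n ℕ.∣ x
  3^∣⇒∣ n = subst (ℕ._∣ _) (∣3^n∣ n) ∘ ∣⇒∣ᵤ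

  ∣⇒3^∣ : ∀ n {x} → 3 ℕ.^ n ℕ.∣ x → 3^ n ∣ + x
  ∣⇒3^∣ n = ∣ᵤ⇒∣ ∘ subst (ℕ._∣ _) (sym (∣3^n∣ n))

  euclidsLemmaℤ : ∀ {p} i j → Prime p → + p ∣ i * j → (+ p ∣ i) ⊎ (+ p ∣ j)
  euclidsLemmaℤ i j p-prime p∣ij
    with euclidsLemma ∣ i ∣ ∣ j ∣ p-prime (subst (_ ℕ.∣_) (abs-* i j) (∣⇒∣ᵤ p∣ij))
  ... | inj₁ p∣i = inj₁ (∣ᵤ⇒∣ p∣i)
  ... | inj₂ p∣j = inj₂ (∣ᵤ⇒∣ p∣j)

  hasVal-dominant : ∀ K {x z} y → + x ≡ z + 3^ K * y → 3^ suc K ∣ z → ¬ + 3 ∣ y → HasVal 3 x (just K)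
  hasVal-dominant K {x} {z} y x≡ 3ᴷ⁺¹∣z 3∤y =
    3^∣⇒∣ K 3ᴷ∣x , 3∤y ∘ 3ᴷ⁺¹∣x⇒3∣y ∘ ∣⇒3^∣ (suc K)
    where
    3ᴷ∣x : 3^ K ∣ + x
    3ᴷ∣x = subst (3^ K ∣_) (sym x≡)
             (∣m∣n⇒∣m+n (∣-trans (3^-∣ 1 {K} refl) 3ᴷ⁺¹∣z) (∣m⇒∣m*n y ∣-refl))
    3ᴷ⁺¹∣x⇒3∣y : 3^ suc K ∣ + x → + 3 ∣ y
    3ᴷ⁺¹∣x⇒3∣y 3ᴷ⁺¹∣x =
      *-cancelˡ-∣ (3^ K) {{3^-nonZero K}} $ subst (_∣ 3^ K * y) (*-comm (+ 3) (3^ K)) $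
        ∣m+n∣m⇒∣n (subst (3^ suc K ∣_) x≡ 3ᴷ⁺¹∣x) 3ᴷ⁺¹∣z

  module _ {P g} (raises : RaisesContent P (suc g)) {f} (nar : IsNarayana f) where

    valuation-grows : f 0 ≡ 1ℤ → ∀ {d} w → Δ P f 0 ≡ 3^ d * w → ¬ + 3 ∣ w → d < suc g ℕ.+ suc g →
                      ∀ {m} k {x} → HasVal 3 m (just k) → + x ≡ f (m ℕ.* P) - 1ℤ →
                      HasVal 3 x (just (k ℕ.+ d))
    valuation-grows f0≡1 {d} w Δ≡ 3∤w d<2g {m} k {x} valᵐ x≡ with hasVal⇒factor k valᵐ
    ... | u , refl , 3∤u =
      hasVal-dominant (k ℕ.+ d) (+ u * w) x≡E+ (∣-trans (3^-mono-∣ bound) (expansion raises nar k u 0)) 3∤uw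
      where
      E : ℤ
      E = f (u ℕ.* (3 ℕ.^ k ℕ.* P)) - f 0 - + u * 3^ k * Δ P f 0
      bound : suc (k ℕ.+ d) ≤ k ℕ.+ (suc g ℕ.+ suc g)
      bound = subst (_≤ k ℕ.+ (suc g ℕ.+ suc g)) (ℕ.+-suc k d) (ℕ.+-monoʳ-≤ k d<2g)
      3∤uw : ¬ + 3 ∣ + u * w
      3∤uw 3∣uw with euclidsLemmaℤ (+ u) w prime-3 3∣uw
      ... | inj₁ 3∣u = 3∤u (∣⇒∣ᵤ 3∣u)
      ... | inj₂ 3∣w = 3∤w 3∣w
      x≡E+ : + x ≡ E + 3^ (k ℕ.+ d) * (+ u * w)
      x≡E+ = begin
        + x                                     ≡⟨ x≡ ⟩
        f (u ℕ.* 3 ℕ.^ k ℕ.* P) - 1ℤ           ≡⟨ cong (λ n → f n - 1ℤ) (ℕ.*-assoc u (3 ℕ.^ k) P) ⟩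
        f (u ℕ.* (3 ℕ.^ k ℕ.* P)) - 1ℤ
          ≡⟨ split (f (u ℕ.* (3 ℕ.^ k ℕ.* P))) (f 0) (+ u * 3^ k) (Δ P f 0) ⟩
        E + (f 0 - 1ℤ) + + u * 3^ k * Δ P f 0
          ≡⟨ cong₂ (λ a b → E + (a - 1ℤ) + + u * 3^ k * b) f0≡1 Δ≡ ⟩
        E + (1ℤ - 1ℤ) + + u * 3^ k * (3^ d * w) ≡⟨ collect E (+ u) (3^ k) (3^ d) w ⟩
        E + 3^ k * 3^ d * (+ u * w)             ≡⟨ cong (λ t → E + t * (+ u * w)) (^-distribˡ-+-* (+ 3) k d) ⟨
        E + 3^ (k ℕ.+ d) * (+ u * w)            ∎
        where
        open ≡-Reasoning
        split : ∀ a b c δ → a - 1ℤ ≡ (a - b - c * δ) + (b - 1ℤ) + c * δ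
        split = solve-∀
        collect : ∀ e u s t w → e + (1ℤ - 1ℤ) + u * s * (t * w) ≡ e + s * t * (u * w)
        collect = solve-∀

    valuation-constant : ∀ {d} w → f 0 - 1ℤ ≡ 3^ d * w → ¬ + 3 ∣ w → 3^ suc d ∣ Δ P f 0 →
                         d < suc g ℕ.+ suc g → ∀ m {x} → + x ≡ f (m ℕ.* P) - 1ℤ → HasVal 3 x (just d)
    valuation-constant {d} w f0-1≡ 3∤w 3ᵈ⁺¹∣Δ d<2g m {x} x≡ =
      hasVal-dominant d w x≡E+
        (∣m∣n⇒∣m+n (∣-trans (3^-mono-∣ bound) (Δ-linear raises 0 nar 3^0-∣ₛ m 0))
                   (∣n⇒∣m*n (+ m) 3ᵈ⁺¹∣Δ))
        3∤w
      where
      E : ℤ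
      E = f (m ℕ.* P) - f 0 - + m * Δ P f 0
      bound : suc d ≤ suc g ℕ.+ (suc g ℕ.+ 0)
      bound = subst (suc d ≤_) (cong (suc g ℕ.+_) (sym (ℕ.+-identityʳ (suc g)))) d<2g
      x≡E+ : + x ≡ (E + + m * Δ P f 0) + 3^ d * w
      x≡E+ = trans x≡ (trans (split (f (m ℕ.* P)) (f 0) (+ m * Δ P f 0))
                             (cong (λ t → E + + m * Δ P f 0 + t) f0-1≡))
        where split : ∀ a b c → a - 1ℤ ≡ (a - b - c + c) + (b - 1ℤ)
              split = solve-∀

module Evaluation where

  open import Data.Nat using (ℕ; zero; suc; _+_)
  open import Data.Product using (_×_; _,_; proj₁)
  open import Function.Strict using (_$!_; force-≡)
  open import Relation.Binary.PropositionalEquality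
  open import Defs using (narayana)

  -- Forcing the new entry keeps evaluation linear: the normaliser does not share the
  -- unevaluated sum, which would otherwise be copied into two later entries.
  narayana³ : ℕ → ℕ × ℕ × ℕ
  narayana³ zero    = 0 , 1 , 1
  narayana³ (suc n) with narayana³ n
  ... | a , b , c = (λ s → b , c , s) $! c + a

  narayana³-correct : ∀ n → narayana³ n ≡ (narayana n , narayana (1 + n) , narayana (2 + n))
  narayana³-correct zero    = refl
  narayana³-correct (suc n) with narayana³ n | narayana³-correct n
  ... | _ | refl = force-≡ (narayana (2 + n) + narayana n) _

  -- Cite this at the index exactly as it occurs in the goal (72 + 18 rather than 90):
  -- otherwise the conversion check unfolds narayana itself, which takes exponential time.
  narayana-by-evaluation : ∀ n {m} → proj₁ (narayana³ n) ≡ m → narayana n ≡ m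
  narayana-by-evaluation n eq = trans (cong proj₁ (sym (narayana³-correct n))) eq

module ResidueClasses where

  open import Data.Nat as ℕ using (ℕ; zero; suc; _+_; _*_; _∸_; _%_; _/_; _≤_; _<_; s≤s; z≤n; NonZero)
  import Data.Nat.Properties as ℕ
  import Data.Nat.Divisibility as ℕ
  open import Data.Nat.DivMod using (m≡m%n+[m/n]*n; m%n<n)
  import Data.Nat.Tactic.RingSolver as ℕ-Solver
  open import Data.Integer as ℤ using (+_; 1ℤ; -[1+_])
  import Data.Integer.Properties as ℤ
  open import Data.Integer.Divisibility.Signed as ℤ using (divides; ∣⇒∣ᵤ)
  open import Data.Maybe using (just)
  open import Data.Product using (∃-syntax; _,_)
  open import Data.Sum using (_⊎_; inj₁; inj₂)
  open import Function using (_$_)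
  open import Relation.Nullary using (¬_)
  open import Relation.Nullary.Decidable using (False; toWitnessFalse; from-yes)
  open import Relation.Binary.PropositionalEquality
  open import Defs
  open NarayanaSequences
  open ThreeAdicContent
  open NarayanaValuation
  open Valuation prime-3
  open Evaluation

  3∤ : ∀ n {3∤n : False (3 ℕ.∣? n)} → ¬ 3 ℕ.∣ n
  3∤ n {3∤n} = toWitnessFalse 3∤n

  3∤ℤ : ∀ w {3∤w : False (3 ℕ.∣? ℤ.∣ w ∣)} → ¬ + 3 ℤ.∣ w
  3∤ℤ w {3∤w} 3∣w = toWitnessFalse 3∤w (∣⇒∣ᵤ 3∣w)

  hasVal-8 : HasVal 3 8 (just 0)
  hasVal-8 = factor⇒hasVal 0 (3∤ 8)

  hasVal-24 : HasVal 3 24 (just 1)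
  hasVal-24 = factor⇒hasVal 1 (3∤ 8)

  narayana-positive : ∀ n → 1 ≤ narayana (suc n)
  narayana-positive zero          = s≤s z≤n
  narayana-positive (suc zero)    = s≤s z≤n
  narayana-positive (suc (suc n)) = ℕ.≤-trans (narayana-positive (suc n)) (ℕ.m≤m+n _ _)

  narayana∸1 : ∀ {i} → 1 ≤ i → + (narayana i ∸ 1) ≡ narayanaℤ i ℤ.- 1ℤ
  narayana∸1 {suc i} _ with narayana (suc i) | narayana-positive i
  ... | suc a | _ = refl

  residue : ∀ {ρ} i n .{{_ : NonZero n}} → i % n ≡ ρ → ∃[ t ] i ≡ ρ + t * n
  residue i n i%n≡ρ = i / n , trans (m≡m%n+[m/n]*n i n) (cong (_+ i / n * n) i%n≡ρ)

  residue-mod-3 : ∀ t → ∃[ s ] (t ≡ 0 + s * 3 ⊎ t ≡ 1 + s * 3 ⊎ t ≡ 2 + s * 3)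
  residue-mod-3 t = t / 3 , by-remainder (t % 3) (m≡m%n+[m/n]*n t 3) (m%n<n t 3)
    where
    by-remainder : ∀ ρ → t ≡ ρ + t / 3 * 3 → ρ < 3 →
                   t ≡ 0 + t / 3 * 3 ⊎ t ≡ 1 + t / 3 * 3 ⊎ t ≡ 2 + t / 3 * 3
    by-remainder 0 t≡ _ = inj₁ t≡
    by-remainder 1 t≡ _ = inj₂ (inj₁ t≡)
    by-remainder 2 t≡ _ = inj₂ (inj₂ t≡)
    by-remainder (suc (suc (suc _))) _ (s≤s (s≤s (s≤s ())))

  module _ {P g} (raises : RaisesContent P (suc g)) {f} (nar : IsNarayana f) where

    narayana-valuation-grows :
      f 0 ≡ 1ℤ → ∀ {a d} w → f P ≡ + a → + a ℤ.- f 0 ≡ 3^ d ℤ.* w → ¬ + 3 ℤ.∣ w →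
      d < suc g + suc g → ∀ {c} j {e} → HasVal 3 c (just j) → d ≡ j + e →
      ∀ i M → 1 ≤ i → f (M * P) ≡ narayanaℤ i →
      ∀ {r} → HasVal 3 (M * c) r → HasVal 3 (narayana i ∸ 1) (r +∞ e)
    narayana-valuation-grows f0≡1 w fP≡a a-f0≡ 3∤w d<2g j valᶜ d≡j+e i zero 1≤i f0≡aᵢ valᴹᶜ
      with hasVal-zero valᴹᶜ
    ... | refl = cong (_∸ 1) (ℤ.+-injective (trans (sym f0≡aᵢ) f0≡1))
    narayana-valuation-grows f0≡1 w fP≡a a-f0≡ 3∤w d<2g j {e} valᶜ d≡j+e i (suc M) 1≤i fM≡aᵢ valᴹᶜ
      with hasVal-exists (suc M)
    ... | k , valᴹ with hasVal-unique (k + j) (hasVal-* k j valᴹ valᶜ) valᴹᶜ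
    ... | refl =
      subst (λ t → HasVal 3 (narayana i ∸ 1) (just t))
            (trans (cong (λ t → k + t) d≡j+e) (sym (ℕ.+-assoc k j e)))
            (valuation-grows raises nar f0≡1 w (trans (cong (ℤ._- f 0) fP≡a) a-f0≡) 3∤w d<2g k valᴹ
               (trans (narayana∸1 1≤i) (cong (ℤ._- 1ℤ) (sym fM≡aᵢ))))

    narayana-valuation-constant :
      ∀ {a d} w → f 0 ℤ.- 1ℤ ≡ 3^ d ℤ.* w → ¬ + 3 ℤ.∣ w →
      f P ≡ + a → 3^ suc d ℤ.∣ + a ℤ.- f 0 →
      d < suc g + suc g → ∀ i M → 1 ≤ i → f (M * P) ≡ narayanaℤ i → HasVal 3 (narayana i ∸ 1) (just d)
    narayana-valuation-constant {d = d} w f0-1≡ 3∤w fP≡a 3ᵈ⁺¹∣a-f0 d<2g i M 1≤i fM≡aᵢ =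
      valuation-constant raises nar w f0-1≡ 3∤w
        (subst (λ t → 3^ suc d ℤ.∣ t ℤ.- f 0) (sym fP≡a) 3ᵈ⁺¹∣a-f0)
        d<2g M (trans (narayana∸1 1≤i) (cong (ℤ._- 1ℤ) (sym fM≡aᵢ)))

  val-at-constant-residue-mod-8 :
    ∀ ρ w → narayanaℤ ρ ℤ.- 1ℤ ≡ 3^ 0 ℤ.* w → ¬ + 3 ℤ.∣ w →
    3^ 1 ℤ.∣ narayanaℤ (8 + ρ) ℤ.- narayanaℤ ρ →
    ∀ i → i % 8 ≡ ρ → 1 ≤ i → HasVal 3 (narayana i ∸ 1) (just 0)
  val-at-constant-residue-mod-8 ρ w aᵨ-1≡ 3∤w 3∣Δ i i%8≡ρ 1≤i with residue i 8 i%8≡ρ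
  ... | t , refl =
    narayana-valuation-constant raises-8 (shift-isNarayana ρ narayanaℤ-isNarayana) w aᵨ-1≡ 3∤w refl 3∣Δ
      (s≤s z≤n) (ρ + t * 8) t 1≤i (cong narayanaℤ (ℕ.+-comm (t * 8) ρ))

  val-at-0457-mod-8 : ∀ i → 1 ≤ i → (i % 8 ≡ 0 ⊎ i % 8 ≡ 4 ⊎ i % 8 ≡ 5 ⊎ i % 8 ≡ 7) →
                      HasVal 3 (narayana i ∸ 1) (just 0)
  val-at-0457-mod-8 i 1≤i (inj₁ i%8≡0) =
    val-at-constant-residue-mod-8 0 -[1+ 0 ] refl (3∤ℤ -[1+ 0 ]) (divides (+ 3) refl) i i%8≡0 1≤i
  val-at-0457-mod-8 i 1≤i (inj₂ (inj₁ i%8≡4)) =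
    val-at-constant-residue-mod-8 4 (+ 1) refl (3∤ℤ (+ 1)) (divides (+ 13) refl) i i%8≡4 1≤i
  val-at-0457-mod-8 i 1≤i (inj₂ (inj₂ (inj₁ i%8≡5))) =
    val-at-constant-residue-mod-8 5 (+ 2) refl (3∤ℤ (+ 2)) (divides (+ 19) refl) i i%8≡5 1≤i
  val-at-0457-mod-8 i 1≤i (inj₂ (inj₂ (inj₂ i%8≡7))) =
    val-at-constant-residue-mod-8 7 (+ 5) refl (3∤ℤ (+ 5)) (divides (+ 41) refl) i i%8≡7 1≤i

  val-at-1-mod-8 : ∀ i → i % 8 ≡ 1 → ∀ r → HasVal 3 (i ∸ 1) r → HasVal 3 (narayana i ∸ 1) (r +∞ 1)
  val-at-1-mod-8 i i%8≡1 r with residue i 8 i%8≡1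
  ... | t , refl =
    narayana-valuation-grows raises-8 (shift-isNarayana 1 narayanaℤ-isNarayana) refl (+ 4) refl refl
      (3∤ℤ (+ 4)) ℕ.≤-refl 0 hasVal-8 refl
      (1 + t * 8) t (s≤s z≤n) (cong narayanaℤ (ℕ.+-comm (t * 8) 1))

  val-at-6-mod-8 : ∀ i → i % 8 ≡ 6 → ∀ r → HasVal 3 (i + 2) r → HasVal 3 (narayana i ∸ 1) (r +∞ 1)
  val-at-6-mod-8 i i%8≡6 r val with residue i 8 i%8≡6
  ... | t , refl =
    narayana-valuation-grows raises-8 (back-isNarayana 2 narayanaℤ-isNarayana) refl (+ 1) refl refl
      (3∤ℤ (+ 1)) ℕ.≤-refl 0 hasVal-8 refl
      (6 + t * 8) (suc t) (s≤s z≤n) (back-shift {narayanaℤ} 2 (6 + t * 8))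
      (subst (λ x → HasVal 3 x r) (index t) val)
    where index : ∀ t → 6 + t * 8 + 2 ≡ suc t * 8
          index = ℕ-Solver.solve-∀

  val-at-2-mod-24 : ∀ i → i % 24 ≡ 2 → ∀ r → HasVal 3 (i ∸ 2) r → HasVal 3 (narayana i ∸ 1) (r +∞ 2)
  val-at-2-mod-24 i i%24≡2 r with residue i 24 i%24≡2
  ... | t , refl =
    narayana-valuation-grows raises-24 (shift-isNarayana 2 narayanaℤ-isNarayana) refl (+ 320)
      (cong +_ (narayana-by-evaluation (24 + 2) refl)) refl
      (3∤ℤ (+ 320)) ℕ.≤-refl 1 hasVal-24 refl
      (2 + t * 24) t (s≤s z≤n) (cong narayanaℤ (ℕ.+-comm (t * 24) 2))

  val-at-10-mod-24 : ∀ i → i % 24 ≡ 10 → HasVal 3 (narayana i ∸ 1) (just 2)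
  val-at-10-mod-24 i i%24≡10 with residue i 24 i%24≡10
  ... | t , refl =
    narayana-valuation-constant raises-24 (shift-isNarayana 10 narayanaℤ-isNarayana) (+ 2) refl (3∤ℤ (+ 2))
      (cong +_ (narayana-by-evaluation (24 + 10) refl)) (divides (+ 6811) refl)
      (from-yes (2 ℕ.<? 4)) (10 + t * 24) t (s≤s z≤n) (cong narayanaℤ (ℕ.+-comm (t * 24) 10))

  val-at-3-mod-24 : ∀ i → i % 24 ≡ 3 → ∀ r → HasVal 3 (i ∸ 3) r → HasVal 3 (narayana i ∸ 1) (r +∞ 2)
  val-at-3-mod-24 i i%24≡3 r with residue i 24 i%24≡3
  ... | t , refl =
    narayana-valuation-grows raises-24 (shift-isNarayana 3 narayanaℤ-isNarayana) refl (+ 469)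
      (cong +_ (narayana-by-evaluation (24 + 3) refl)) refl
      (3∤ℤ (+ 469)) ℕ.≤-refl 1 hasVal-24 refl
      (3 + t * 24) t (s≤s z≤n) (cong narayanaℤ (ℕ.+-comm (t * 24) 3))

  val-at-11-mod-24 : ∀ i → i % 24 ≡ 11 → ∀ r → HasVal 3 (i + 13) r → HasVal 3 (narayana i ∸ 1) (r +∞ 2)
  val-at-11-mod-24 i i%24≡11 r val with residue i 24 i%24≡11
  ... | t , refl =
    narayana-valuation-grows raises-24 (back-isNarayana 13 narayanaℤ-isNarayana) refl (+ 1) refl refl
      (3∤ℤ (+ 1)) ℕ.≤-refl 1 hasVal-24 refl
      (11 + t * 24) (suc t) (s≤s z≤n) (back-shift {narayanaℤ} 13 (11 + t * 24))
      (subst (λ x → HasVal 3 x r) (index t) val)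
    where index : ∀ t → 11 + t * 24 + 13 ≡ suc t * 24
          index = ℕ-Solver.solve-∀

  val-at-19-mod-24 : ∀ i → i % 24 ≡ 19 → ∀ r → HasVal 3 (i + 5) r → HasVal 3 (narayana i ∸ 1) (r +∞ 2)
  val-at-19-mod-24 i i%24≡19 r val with residue i 24 i%24≡19
  ... | t , refl =
    narayana-valuation-grows raises-24 (back-isNarayana 5 narayanaℤ-isNarayana) refl (+ 22) refl refl
      (3∤ℤ (+ 22)) ℕ.≤-refl 1 hasVal-24 refl
      (19 + t * 24) (suc t) (s≤s z≤n) (back-shift {narayanaℤ} 5 (19 + t * 24))
      (subst (λ x → HasVal 3 x r) (index t) val)
    where index : ∀ t → 19 + t * 24 + 5 ≡ suc t * 24
          index = ℕ-Solver.solve-∀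

  hasVal-product-at-18-mod-72 : ∀ s → HasVal 3 ((18 + s * 72 + 6) * (18 + s * 72 + 30)) (just 2)
  hasVal-product-at-18-mod-72 s =
    subst (λ x → HasVal 3 x (just 2)) (index s)
      (factor⇒hasVal 2 (∤-* (3∤ 64) (∤-* (∤-+-multiple s (3∤ 1)) (∤-+-multiple s (3∤ 2)))))
    where index : ∀ s → 64 * ((3 * s + 1) * (3 * s + 2)) * 3 ℕ.^ 2 ≡ (18 + s * 72 + 6) * (18 + s * 72 + 30)
          index = ℕ-Solver.solve-∀

  val-at-18-mod-72 : ∀ s r → HasVal 3 ((18 + s * 72 + 6) * (18 + s * 72 + 30)) r →
                     HasVal 3 (narayana (18 + s * 72) ∸ 1) (r +∞ 2)
  val-at-18-mod-72 s r val =
    subst (λ r → HasVal 3 (narayana (18 + s * 72) ∸ 1) (r +∞ 2))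
          (sym (hasVal-unique 2 (hasVal-product-at-18-mod-72 s) val)) $
      narayana-valuation-constant raises-72 (shift-isNarayana 18 narayanaℤ-isNarayana) (+ 5) refl (3∤ℤ (+ 5))
        (cong +_ (narayana-by-evaluation (72 + 18) refl)) (divides (+ 1497619220418) refl)
        (from-yes (4 ℕ.<? 6)) (18 + s * 72) s (s≤s z≤n) (cong narayanaℤ (ℕ.+-comm (s * 72) 18))

  val-at-42-mod-72 : ∀ s r → HasVal 3 ((42 + s * 72 + 6) * (42 + s * 72 + 30)) r →
                     HasVal 3 (narayana (42 + s * 72) ∸ 1) (r +∞ 2)
  val-at-42-mod-72 s r val =
    narayana-valuation-grows raises-72 (back-isNarayana 30 narayanaℤ-isNarayana) refl (+ 16109)
      (trans (back-shift {narayanaℤ} 30 42) (cong +_ (narayana-by-evaluation 42 refl))) refl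
      (3∤ℤ (+ 16109)) ℕ.≤-refl 3 (factor⇒hasVal 3 (∤-* (3∤ 64) (∤-+-multiple s (3∤ 2)))) refl
      (42 + s * 72) (suc s) (s≤s z≤n) (back-shift {narayanaℤ} 30 (42 + s * 72))
      (subst (λ x → HasVal 3 x r) (index s) val)
    where index : ∀ s → (42 + s * 72 + 6) * (42 + s * 72 + 30) ≡ suc s * (64 * (3 * s + 2) * 3 ℕ.^ 3)
          index = ℕ-Solver.solve-∀

  val-at-66-mod-72 : ∀ s r → HasVal 3 ((66 + s * 72 + 6) * (66 + s * 72 + 30)) r →
                     HasVal 3 (narayana (66 + s * 72) ∸ 1) (r +∞ 2)
  val-at-66-mod-72 s r val =
    narayana-valuation-grows raises-72 (back-isNarayana 6 narayanaℤ-isNarayana) refl (+ 155322742)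
      (trans (back-shift {narayanaℤ} 6 66) (cong +_ (narayana-by-evaluation 66 refl))) refl
      (3∤ℤ (+ 155322742)) ℕ.≤-refl 3 (factor⇒hasVal 3 (∤-* (3∤ 64) (∤-+-multiple s (3∤ 4)))) refl
      (66 + s * 72) (suc s) (s≤s z≤n) (back-shift {narayanaℤ} 6 (66 + s * 72))
      (subst (λ x → HasVal 3 x r) (index s) val)
    where index : ∀ s → (66 + s * 72 + 6) * (66 + s * 72 + 30) ≡ suc s * (64 * (3 * s + 4) * 3 ℕ.^ 3)
          index = ℕ-Solver.solve-∀

  val-at-18-mod-24 : ∀ i → i % 24 ≡ 18 → ∀ r → HasVal 3 ((i + 6) * (i + 30)) r →
                     HasVal 3 (narayana i ∸ 1) (r +∞ 2)
  val-at-18-mod-24 i i%24≡18 r with residue i 24 i%24≡18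
  ... | t , refl = by-residue-mod-3 (residue-mod-3 t)
    where
    Claim : ℕ → Set
    Claim i = HasVal 3 ((i + 6) * (i + 30)) r → HasVal 3 (narayana i ∸ 1) (r +∞ 2)
    index₀ : ∀ s → 18 + s * 72 ≡ 18 + (0 + s * 3) * 24
    index₀ = ℕ-Solver.solve-∀
    index₁ : ∀ s → 42 + s * 72 ≡ 18 + (1 + s * 3) * 24
    index₁ = ℕ-Solver.solve-∀
    index₂ : ∀ s → 66 + s * 72 ≡ 18 + (2 + s * 3) * 24
    index₂ = ℕ-Solver.solve-∀
    by-residue-mod-3 : ∃[ s ] (t ≡ 0 + s * 3 ⊎ t ≡ 1 + s * 3 ⊎ t ≡ 2 + s * 3) → Claim (18 + t * 24)
    by-residue-mod-3 (s , inj₁ refl)        = subst Claim (index₀ s) (val-at-18-mod-72 s r)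
    by-residue-mod-3 (s , inj₂ (inj₁ refl)) = subst Claim (index₁ s) (val-at-42-mod-72 s r)
    by-residue-mod-3 (s , inj₂ (inj₂ refl)) = subst Claim (index₂ s) (val-at-66-mod-72 s r)

open import Defs
open import Data.Nat using (ℕ; _+_; _*_; _∸_; _%_; _≥_)
open import Data.Maybe using (just)
open import Data.Product using (_×_; _,_)
open import Data.Sum using (_⊎_)
open import Relation.Binary.PropositionalEquality using (_≡_)
open ResidueClasses

theorem3p5 : (i : ℕ) → i ≥ 1 →
    ((i % 8 ≡ 0 ⊎ i % 8 ≡ 4 ⊎ i % 8 ≡ 5 ⊎ i % 8 ≡ 7) → HasVal 3 (narayana i ∸ 1) (just 0))
    × (i % 8 ≡ 1 → ∀ r → HasVal 3 (i ∸ 1) r → HasVal 3 (narayana i ∸ 1) (r +∞ 1))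
    × (i % 8 ≡ 6 → ∀ r → HasVal 3 (i + 2) r → HasVal 3 (narayana i ∸ 1) (r +∞ 1))
    × (i % 24 ≡ 2 → ∀ r → HasVal 3 (i ∸ 2) r → HasVal 3 (narayana i ∸ 1) (r +∞ 2))
    × (i % 24 ≡ 10 → HasVal 3 (narayana i ∸ 1) (just 2))
    × (i % 24 ≡ 18 → ∀ r → HasVal 3 ((i + 6) * (i + 30)) r → HasVal 3 (narayana i ∸ 1) (r +∞ 2))
    × (i % 24 ≡ 3 → ∀ r → HasVal 3 (i ∸ 3) r → HasVal 3 (narayana i ∸ 1) (r +∞ 2))
    × (i % 24 ≡ 11 → ∀ r → HasVal 3 (i + 13) r → HasVal 3 (narayana i ∸ 1) (r +∞ 2))
    × (i % 24 ≡ 19 → ∀ r → HasVal 3 (i + 5) r → HasVal 3 (narayana i ∸ 1) (r +∞ 2))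
theorem3p5 i i≥1 =
  val-at-0457-mod-8 i i≥1 , val-at-1-mod-8 i , val-at-6-mod-8 i , val-at-2-mod-24 i , val-at-10-mod-24 i ,
  val-at-18-mod-24 i , val-at-3-mod-24 i , val-at-11-mod-24 i , val-at-19-mod-24 i
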